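{- Let $p$ be a prime and work in the rational function field $\mathbb{F}_p(x,y)$. For every $k\ge1$, $$\nu^{\theta(2k-1,p)}=\frac{[1,2][2k,2k+2][2k+1,2k+2]}{[0,1][0,2][2k,2k+1]}\,[0,1]^{ -2\theta(2k+1,p)}.$$
   Context: For integers $i,j\ge0$, $[i,j]:=x^{p^i}y^{p^j}-x^{p^j}y^{p^i}\in\mathbb{F}_p[x,y]$, where $x,y$ are indeterminates. $\nu:=-\dfrac{[0,2][1,3]}{[0,1][2,3]}$. For $r\ge0$, $\theta(r,p):=\sum_{i=0}^{r}(-1)^{r-i}p^i=p^r-p^{r-1}+\cdots+(-1)^r$. -}

module Defs where

open import Data.Nat as ℕ using (ℕ; zero; suc; _∸_)
open import Data.Integer as ℤ using (ℤ; 0ℤ; 1ℤ)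
open import Data.Integer.Divisibility using () renaming (_∣_ to _∣ℤ_)
open import Data.List using (List; foldr; upTo; map; concatMap)
open import Relation.Nullary using (Dec; yes; no)
open import Data.Nat using (_≟_)

-- Polynomials in x, y over F_p, represented by their integer coefficient
-- families: f a b is (a lift to ℤ of) the coefficient of x^a y^b.
Poly : Set
Poly = ℕ → ℕ → ℤ

_≈[_]_ : Poly → ℕ → Poly → Set
f ≈[ p ] g = ∀ a b → ℤ.+ p ∣ℤ (f a b ℤ.- g a b)

sumℤ : List ℤ → ℤ
sumℤ = foldr ℤ._+_ 0ℤ

_⊕_ : Poly → Poly → Poly
(f ⊕ g) a b = f a b ℤ.+ g a b

⊖_ : Poly → Poly
(⊖ f) a b = ℤ.- f a b

_⊗_ : Poly → Poly → Poly
(f ⊗ g) a b =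
  sumℤ (concatMap (λ i → map (λ j → f i j ℤ.* g (a ∸ i) (b ∸ j)) (upTo (suc b)))
                  (upTo (suc a)))

one : Poly
one zero zero = 1ℤ
one _    _    = 0ℤ

mono : ℕ → ℕ → Poly
mono m n a b with a ≟ m | b ≟ n
... | yes _ | yes _ = 1ℤ
... | _     | _     = 0ℤ

_^ᴾ_ : Poly → ℕ → Poly
f ^ᴾ zero  = one
f ^ᴾ suc n = f ⊗ (f ^ᴾ n)

-- [i,j] = x^{p^i} y^{p^j} - x^{p^j} y^{p^i}
br : ℕ → ℕ → ℕ → Poly
br p i j = mono (p ℕ.^ i) (p ℕ.^ j) ⊕ (⊖ mono (p ℕ.^ j) (p ℕ.^ i))

record Frac : Set where
  constructor _//_
  field
    num : Poly
    den : Poly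
open Frac public

_≈F[_]_ : Frac → ℕ → Frac → Set
u ≈F[ p ] v = (num u ⊗ den v) ≈[ p ] (num v ⊗ den u)

_*F_ : Frac → Frac → Frac
u *F v = (num u ⊗ num v) // (den u ⊗ den v)

_^F_ : Frac → ℕ → Frac
u ^F n = (num u ^ᴾ n) // (den u ^ᴾ n)

_^F-_ : Frac → ℕ → Frac
u ^F- n = (den u ^ᴾ n) // (num u ^ᴾ n)

poly : Poly → Frac
poly f = f // one

ν : ℕ → Frac
ν p = (⊖ (br p 0 2 ⊗ br p 1 3)) // (br p 0 1 ⊗ br p 2 3)

-- θ(r,p) = p^r - p^{r-1} + ... + (-1)^r  (always ≥ 0; the truncated
-- subtraction is exact since θ(r,p) ≤ p^r)
θ : ℕ → ℕ → ℕ
θ zero    p = 1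
θ (suc r) p = p ℕ.^ suc r ∸ θ r p

{-# OPTIONS --safe #-}
-- Write u = [0,1] and v = [0,2]. In characteristic p the map x ↦ x^p is additive, so
-- [n,n+1] = u^(p^n) and [n,n+2] = v^(p^n), and after clearing denominators both sides of the
-- identity are monomials u^a v^b. Their exponents agree because (1+p)·θ(2k−1) = p^(2k) − 1 and
-- θ(2k+1) = p²·θ(2k−1) + p − 1, and the sign (−1)^θ(2k−1) is 1 because θ(2k−1) is a multiple
-- of p − 1. The computation takes place in the ring of double power series over ℤ/pℤ, of which
-- the coefficient families Poly are the elements.
module Submission where

open import Defs
open import Algebra.Bundles using (CommutativeRing; CommutativeSemiring)
open import Algebra.Core using (Op₂)
open import Algebra.Structures using (IsCommutativeRing)
import Algebra.Construct.Pointwise as Pointwise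
open import Data.Nat.Base as ℕ using (ℕ; zero; suc; _∸_; _<_)
open import Data.Nat.Primality using (Prime)
open import Data.Product.Base using (_,_)
open import Function.Base using (_∘_; id)

module PowerSeries {c ℓ} (R : CommutativeRing c ℓ) where
  open CommutativeRing R hiding (zero)
  open import Algebra.Properties.CommutativeSemigroup +-commutativeSemigroup using (interchange)
  open import Algebra.Properties.Semiring.Mult semiring using (_×_)
  open import Relation.Binary.Reasoning.Setoid setoid
  open import Relation.Binary.PropositionalEquality as ≡ using (_≡_; _≢_)
  open import Data.Empty using (⊥-elim)

  Series : Set c
  Series = ℕ → Carrier

  infix 4 _≋_
  _≋_ : Series → Series → Set ℓ
  f ≋ g = ∀ n → f n ≈ g n

  sum≤ : (ℕ → Carrier) → ℕ → Carrier
  sum≤ F zero    = F zero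
  sum≤ F (suc n) = F zero + sum≤ (F ∘ suc) n

  sum≤-cong : ∀ {F G} → (∀ i → F i ≈ G i) → ∀ n → sum≤ F n ≈ sum≤ G n
  sum≤-cong F≈G zero    = F≈G zero
  sum≤-cong F≈G (suc n) = +-cong (F≈G zero) (sum≤-cong (F≈G ∘ suc) n)

  sum≤-+ : ∀ F G n → sum≤ (λ i → F i + G i) n ≈ sum≤ F n + sum≤ G n
  sum≤-+ F G zero    = refl
  sum≤-+ F G (suc n) = trans (+-congˡ (sum≤-+ (F ∘ suc) (G ∘ suc) n)) (interchange _ _ _ _)

  sum≤-*ˡ : ∀ a F n → sum≤ (λ i → a * F i) n ≈ a * sum≤ F n
  sum≤-*ˡ a F zero    = refl
  sum≤-*ˡ a F (suc n) = trans (+-congˡ (sum≤-*ˡ a (F ∘ suc) n)) (sym (distribˡ a _ _))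

  sum≤-zero : ∀ {F} → (∀ i → F i ≈ 0#) → ∀ n → sum≤ F n ≈ 0#
  sum≤-zero F≈0 zero    = F≈0 zero
  sum≤-zero F≈0 (suc n) = trans (+-cong (F≈0 zero) (sum≤-zero (F≈0 ∘ suc) n)) (+-identityˡ 0#)

  infixl 7 _⋆_
  _⋆_ : Series → Series → Series
  (f ⋆ g) n = sum≤ (λ i → f i * g (n ∸ i)) n

  𝟙 : Series
  𝟙 zero    = 1#
  𝟙 (suc _) = 0#

  ⋆-cong : ∀ {f f′ g g′} → f ≋ f′ → g ≋ g′ → f ⋆ g ≋ f′ ⋆ g′
  ⋆-cong f≋f′ g≋g′ n = sum≤-cong (λ i → *-cong (f≋f′ i) (g≋g′ (n ∸ i))) n

  ⋆-unfoldʳ : ∀ f g n → (f ⋆ g) (suc n) ≈ (f ⋆ (g ∘ suc)) n + f (suc n) * g 0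
  ⋆-unfoldʳ f g zero    = refl
  ⋆-unfoldʳ f g (suc n) = trans (+-congˡ (⋆-unfoldʳ (f ∘ suc) g n)) (sym (+-assoc _ _ _))

  ⋆-comm : ∀ f g → f ⋆ g ≋ g ⋆ f
  ⋆-comm f g zero    = *-comm _ _
  ⋆-comm f g (suc n) = begin
    f 0 * g (suc n) + ((f ∘ suc) ⋆ g) n ≈⟨ +-congˡ (⋆-comm (f ∘ suc) g n) ⟩
    f 0 * g (suc n) + (g ⋆ (f ∘ suc)) n ≈⟨ +-comm _ _ ⟩
    (g ⋆ (f ∘ suc)) n + f 0 * g (suc n) ≈⟨ +-congˡ (*-comm _ _) ⟩
    (g ⋆ (f ∘ suc)) n + g (suc n) * f 0 ≈⟨ ⋆-unfoldʳ g f n ⟨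
    (g ⋆ f) (suc n)                     ∎

  ⋆-distribʳ : ∀ h f g → (λ n → f n + g n) ⋆ h ≋ λ n → (f ⋆ h) n + (g ⋆ h) n
  ⋆-distribʳ h f g n = trans (sum≤-cong (λ i → distribʳ _ _ _) n) (sum≤-+ _ _ n)

  ⋆-distribˡ : ∀ f g h → f ⋆ (λ n → g n + h n) ≋ λ n → (f ⋆ g) n + (f ⋆ h) n
  ⋆-distribˡ f g h n = trans (sum≤-cong (λ i → distribˡ _ _ _) n) (sum≤-+ _ _ n)

  scale-⋆ : ∀ a f g → (λ i → a * f i) ⋆ g ≋ λ n → a * (f ⋆ g) n
  scale-⋆ a f g n = trans (sum≤-cong (λ i → *-assoc _ _ _) n) (sum≤-*ˡ a _ n)

  ⋆-assoc : ∀ f g h → (f ⋆ g) ⋆ h ≋ f ⋆ (g ⋆ h)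
  ⋆-assoc f g h zero    = *-assoc _ _ _
  ⋆-assoc f g h (suc n) = begin
    (f 0 * g 0) * h (suc n) + ((λ m → f 0 * g (suc m) + ((f ∘ suc) ⋆ g) m) ⋆ h) n
      ≈⟨ +-congˡ (⋆-distribʳ h _ _ n) ⟩
    (f 0 * g 0) * h (suc n) + (((λ m → f 0 * g (suc m)) ⋆ h) n + (((f ∘ suc) ⋆ g) ⋆ h) n)
      ≈⟨ +-congˡ (+-cong (scale-⋆ (f 0) (g ∘ suc) h n) (⋆-assoc (f ∘ suc) g h n)) ⟩
    (f 0 * g 0) * h (suc n) + (f 0 * ((g ∘ suc) ⋆ h) n + ((f ∘ suc) ⋆ (g ⋆ h)) n)
      ≈⟨ +-assoc _ _ _ ⟨
    ((f 0 * g 0) * h (suc n) + f 0 * ((g ∘ suc) ⋆ h) n) + ((f ∘ suc) ⋆ (g ⋆ h)) n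
      ≈⟨ +-congʳ (trans (+-congʳ (*-assoc _ _ _)) (sym (distribˡ _ _ _))) ⟩
    f 0 * (g ⋆ h) (suc n) + ((f ∘ suc) ⋆ (g ⋆ h)) n
      ∎

  ⋆-identityˡ : ∀ f → 𝟙 ⋆ f ≋ f
  ⋆-identityˡ f zero    = *-identityˡ _
  ⋆-identityˡ f (suc n) =
    trans (+-congˡ (sum≤-zero (λ i → zeroˡ _) n)) (trans (+-identityʳ _) (*-identityˡ _))

  ⋆-isCommutativeRing : IsCommutativeRing _≋_ (λ f g n → f n + g n) _⋆_ (λ f n → - f n) (λ _ → 0#) 𝟙
  ⋆-isCommutativeRing = record
    { isRing = record
      { +-isAbelianGroup = Pointwise.isAbelianGroup ℕ +-isAbelianGroup
      ; *-cong           = ⋆-cong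
      ; *-assoc          = ⋆-assoc
      ; *-identity       = ⋆-identityˡ , λ f n → trans (⋆-comm f 𝟙 n) (⋆-identityˡ f n)
      ; distrib          = ⋆-distribˡ , λ h f g n → trans (⋆-comm _ h n)
                             (trans (⋆-distribˡ h f g n) (+-cong (⋆-comm h f n) (⋆-comm h g n)))
      }
    ; *-comm = ⋆-comm
    }

  powerSeriesRing : CommutativeRing c ℓ
  powerSeriesRing = record { isCommutativeRing = ⋆-isCommutativeRing }

  open import Algebra.Properties.Semiring.Mult (CommutativeRing.semiring powerSeriesRing)
    using () renaming (_×_ to _×ₛ_)

  ×ₛ-pointwise : ∀ m f n → (m ×ₛ f) n ≈ m × f n
  ×ₛ-pointwise zero    f n = refl
  ×ₛ-pointwise (suc m) f n = +-congˡ (×ₛ-pointwise m f n)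

  ×ₛ-annihilates : ∀ m → (∀ x → m × x ≈ 0#) → ∀ f → m ×ₛ f ≋ (λ _ → 0#)
  ×ₛ-annihilates m m×≈0 f n = trans (×ₛ-pointwise m f n) (m×≈0 (f n))

  monomial : ℕ → Carrier → Series
  monomial zero    a zero    = a
  monomial zero    a (suc _) = 0#
  monomial (suc k) a zero    = 0#
  monomial (suc k) a (suc n) = monomial k a n

  monomial-diagonal : ∀ k a → monomial k a k ≡ a
  monomial-diagonal zero    a = ≡.refl
  monomial-diagonal (suc k) a = monomial-diagonal k a

  monomial-off-diagonal : ∀ {k i} a → i ≢ k → monomial k a i ≡ 0#
  monomial-off-diagonal {zero}  {zero}  a 0≢0 = ⊥-elim (0≢0 ≡.refl)
  monomial-off-diagonal {zero}  {suc i} a _   = ≡.refl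
  monomial-off-diagonal {suc k} {zero}  a _   = ≡.refl
  monomial-off-diagonal {suc k} {suc i} a i≢k = monomial-off-diagonal a (i≢k ∘ ≡.cong suc)

  monomial-cong : ∀ k {a b} → a ≈ b → monomial k a ≋ monomial k b
  monomial-cong zero    a≈b zero    = a≈b
  monomial-cong zero    a≈b (suc n) = refl
  monomial-cong (suc k) a≈b zero    = refl
  monomial-cong (suc k) a≈b (suc n) = monomial-cong k a≈b n

  *-monomial : ∀ k a b → (λ n → a * monomial k b n) ≋ monomial k (a * b)
  *-monomial zero    a b zero    = refl
  *-monomial zero    a b (suc n) = zeroʳ a
  *-monomial (suc k) a b zero    = zeroʳ a
  *-monomial (suc k) a b (suc n) = *-monomial k a b n

  monomial-⋆-monomial : ∀ k l a b → monomial k a ⋆ monomial l b ≋ monomial (k ℕ.+ l) (a * b)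
  monomial-⋆-monomial zero    l a b zero    = *-monomial l a b zero
  monomial-⋆-monomial zero    l a b (suc n) =
    trans (+-congˡ (sum≤-zero (λ i → zeroˡ _) n)) (trans (+-identityʳ _) (*-monomial l a b (suc n)))
  monomial-⋆-monomial (suc k) l a b zero    = zeroˡ _
  monomial-⋆-monomial (suc k) l a b (suc n) =
    trans (+-congʳ (zeroˡ _)) (trans (+-identityˡ _) (monomial-⋆-monomial k l a b n))

module IntegersModulo (n : ℕ) where
  open import Data.Integer.Base as ℤ using (ℤ; +_; 0ℤ; 1ℤ)
  import Data.Integer.Properties as ℤ
  import Data.Integer.Divisibility as Unsigned
  open import Data.Integer.Divisibility.Signed using (_∣_; divides; ∣ᵤ⇒∣; ∣⇒∣ᵤ; ∣m⇒∣-m; ∣m∣n⇒∣m+n; ∣n⇒∣m*n; ∣m⇒∣m*n)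
  open import Data.Integer.Tactic.RingSolver using (solve-∀)
  open import Relation.Binary.PropositionalEquality as ≡ using (_≡_; refl)

  infix 4 _≈_
  -- Unsigned divisibility, as in Defs._≈[_]_.
  _≈_ : ℤ → ℤ → Set
  a ≈ b = + n Unsigned.∣ a ℤ.- b

  ∣-difference : ∀ a b {d} → + n ∣ d → d ≡ a ℤ.- b → a ≈ b
  ∣-difference a b n∣d refl = ∣⇒∣ᵤ n∣d

  difference-∣ : ∀ a b → a ≈ b → + n ∣ a ℤ.- b
  difference-∣ a b = ∣ᵤ⇒∣

  ≡⇒≈ : ∀ {a b} → a ≡ b → a ≈ b
  ≡⇒≈ {a} refl = ∣-difference a a (divides 0ℤ refl) (≡.sym (ℤ.+-inverseʳ a))

  private
    negate-difference : ∀ a b → ℤ.- (a ℤ.- b) ≡ b ℤ.- a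
    negate-difference = solve-∀

    difference-trans : ∀ a b c → (a ℤ.- b) ℤ.+ (b ℤ.- c) ≡ a ℤ.- c
    difference-trans = solve-∀

    difference-+ : ∀ a a′ b b′ → (a ℤ.- a′) ℤ.+ (b ℤ.- b′) ≡ (a ℤ.+ b) ℤ.- (a′ ℤ.+ b′)
    difference-+ = solve-∀

    difference-neg : ∀ a a′ → ℤ.- (a ℤ.- a′) ≡ ℤ.- a ℤ.- ℤ.- a′
    difference-neg = solve-∀

    difference-* : ∀ a a′ b b′ → a ℤ.* (b ℤ.- b′) ℤ.+ (a ℤ.- a′) ℤ.* b′ ≡ a ℤ.* b ℤ.- a′ ℤ.* b′
    difference-* = solve-∀

  ≈-sym : ∀ {a b} → a ≈ b → b ≈ a
  ≈-sym {a} {b} a≈b = ∣-difference b a (∣m⇒∣-m (difference-∣ a b a≈b)) (negate-difference a b)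

  ≈-trans : ∀ {a b c} → a ≈ b → b ≈ c → a ≈ c
  ≈-trans {a} {b} {c} a≈b b≈c =
    ∣-difference a c (∣m∣n⇒∣m+n (difference-∣ a b a≈b) (difference-∣ b c b≈c)) (difference-trans a b c)

  +-cong : ∀ {a a′ b b′} → a ≈ a′ → b ≈ b′ → a ℤ.+ b ≈ a′ ℤ.+ b′
  +-cong {a} {a′} {b} {b′} a≈a′ b≈b′ =
    ∣-difference (a ℤ.+ b) (a′ ℤ.+ b′)
      (∣m∣n⇒∣m+n (difference-∣ a a′ a≈a′) (difference-∣ b b′ b≈b′)) (difference-+ a a′ b b′)

  -‿cong : ∀ {a a′} → a ≈ a′ → ℤ.- a ≈ ℤ.- a′
  -‿cong {a} {a′} a≈a′ = ∣-difference (ℤ.- a) (ℤ.- a′) (∣m⇒∣-m (difference-∣ a a′ a≈a′)) (difference-neg a a′)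

  *-cong : ∀ {a a′ b b′} → a ≈ a′ → b ≈ b′ → a ℤ.* b ≈ a′ ℤ.* b′
  *-cong {a} {a′} {b} {b′} a≈a′ b≈b′ =
    ∣-difference (a ℤ.* b) (a′ ℤ.* b′)
      (∣m∣n⇒∣m+n (∣n⇒∣m*n a (difference-∣ b b′ b≈b′)) (∣m⇒∣m*n b′ (difference-∣ a a′ a≈a′)))
                 (difference-* a a′ b b′)

  isCommutativeRing : IsCommutativeRing _≈_ ℤ._+_ ℤ._*_ ℤ.-_ 0ℤ 1ℤ
  isCommutativeRing = record
    { isRing = record
      { +-isAbelianGroup = record
        { isGroup = record
          { isMonoid = record
            { isSemigroup = record
              { isMagma = record
                { isEquivalence = record { refl = λ {a} → ≡⇒≈ {a} refl
                                  ; sym = λ {a b} → ≈-sym {a} {b}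
                                  ; trans = λ {a b c} → ≈-trans {a} {b} {c}
                                  }
                ; ∙-cong        = λ {a a′ b b′} → +-cong {a} {a′} {b} {b′}
                }
              ; assoc = λ a b c → ≡⇒≈ (ℤ.+-assoc a b c)
              }
            ; identity = (λ a → ≡⇒≈ (ℤ.+-identityˡ a)) , (λ a → ≡⇒≈ (ℤ.+-identityʳ a))
            }
          ; inverse = (λ a → ≡⇒≈ (ℤ.+-inverseˡ a)) , (λ a → ≡⇒≈ (ℤ.+-inverseʳ a))
          ; ⁻¹-cong = λ {a a′} → -‿cong {a} {a′}
          }
        ; comm = λ a b → ≡⇒≈ (ℤ.+-comm a b)
        }
      ; *-cong     = λ {a a′ b b′} → *-cong {a} {a′} {b} {b′}
      ; *-assoc    = λ a b c → ≡⇒≈ (ℤ.*-assoc a b c)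
      ; *-identity = (λ a → ≡⇒≈ (ℤ.*-identityˡ a)) , (λ a → ≡⇒≈ (ℤ.*-identityʳ a))
      ; distrib    = (λ a b c → ≡⇒≈ (ℤ.*-distribˡ-+ a b c)) , (λ a b c → ≡⇒≈ (ℤ.*-distribʳ-+ a b c))
      }
    ; *-comm = λ a b → ≡⇒≈ (ℤ.*-comm a b)
    }

  ℤ/nℤ : CommutativeRing _ _
  ℤ/nℤ = record { isCommutativeRing = isCommutativeRing }

  open import Algebra.Properties.Semiring.Mult (CommutativeRing.semiring ℤ/nℤ) using (_×_)

  ×-as-* : ∀ m z → m × z ≡ + m ℤ.* z
  ×-as-* zero    z = ≡.sym (ℤ.*-zeroˡ z)
  ×-as-* (suc m) z = ≡.trans (≡.cong (λ w → z ℤ.+ w) (×-as-* m z)) (≡.sym (ℤ.suc-* (+ m) z))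

  n×≈0 : ∀ z → n × z ≈ 0ℤ
  n×≈0 z = ∣-difference (n × z) 0ℤ (divides z (ℤ.*-comm (+ n) z)) (≡.sym (≡.trans (ℤ.+-identityʳ _) (×-as-* n z)))

module WithMultiplication {c ℓ} (R : CommutativeRing c ℓ) where
  open CommutativeRing R

  module _ (_*′_ : Op₂ Carrier) (1′ : Carrier) (*′≈* : ∀ x y → x *′ y ≈ x * y) (1′≈1 : 1′ ≈ 1#) where
    private
      *′-cong : ∀ {x x′ y y′} → x ≈ x′ → y ≈ y′ → x *′ y ≈ x′ *′ y′
      *′-cong x≈x′ y≈y′ = trans (*′≈* _ _) (trans (*-cong x≈x′ y≈y′) (sym (*′≈* _ _)))

      *′-assoc : ∀ x y z → (x *′ y) *′ z ≈ x *′ (y *′ z)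
      *′-assoc x y z = trans (*′≈* _ z) (trans (*-cong (*′≈* x y) refl) (trans (*-assoc x y z)
                         (sym (trans (*′≈* x _) (*-cong refl (*′≈* y z))))))

      *′-comm : ∀ x y → x *′ y ≈ y *′ x
      *′-comm x y = trans (*′≈* x y) (trans (*-comm x y) (sym (*′≈* y x)))

      *′-identityˡ : ∀ x → 1′ *′ x ≈ x
      *′-identityˡ x = trans (*′≈* 1′ x) (trans (*-cong 1′≈1 refl) (*-identityˡ x))

      *′-distribˡ : ∀ x y z → x *′ (y + z) ≈ x *′ y + x *′ z
      *′-distribˡ x y z = trans (*′≈* x _) (trans (distribˡ x y z) (sym (+-cong (*′≈* x y) (*′≈* x z))))

    commutativeRing : CommutativeRing c ℓ
    commutativeRing = record
      { Carrier = Carrier ; _≈_ = _≈_ ; _+_ = _+_ ; _*_ = _*′_ ; -_ = -_ ; 0# = 0# ; 1# = 1′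
      ; isCommutativeRing = record
        { isRing = record
          { +-isAbelianGroup = +-isAbelianGroup
          ; *-cong           = *′-cong
          ; *-assoc          = *′-assoc
          ; *-identity       = *′-identityˡ , λ x → trans (*′-comm x 1′) (*′-identityˡ x)
          ; distrib          = *′-distribˡ , λ x y z → trans (*′-comm _ x)
                                 (trans (*′-distribˡ x y z) (+-cong (*′-comm x y) (*′-comm x z)))
          }
        ; *-comm = *′-comm
        }
      }

module BivariatePowerSeries (p : ℕ) where
  open import Data.Integer.Base as ℤ using (ℤ; 0ℤ; 1ℤ) renaming (_+_ to _+ℤ_)
  import Data.Integer.Properties as ℤ
  open import Data.List.Base using (List; []; _∷_; _++_; map; applyUpTo; upTo; concatMap)
  open import Data.Nat.Properties using (_≟_)
  open import Relation.Nullary using (yes; no)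
  open import Relation.Binary.PropositionalEquality as ≡ using (_≡_; refl)
  open IntegersModulo p using (ℤ/nℤ; ≡⇒≈; n×≈0)

  module Y  = PowerSeries ℤ/nℤ
  module XY = PowerSeries Y.powerSeriesRing

  sumℤ-++ : ∀ xs ys → sumℤ (xs ++ ys) ≡ sumℤ xs +ℤ sumℤ ys
  sumℤ-++ []       ys = ≡.sym (ℤ.+-identityˡ _)
  sumℤ-++ (x ∷ xs) ys = ≡.trans (≡.cong (x +ℤ_) (sumℤ-++ xs ys)) (≡.sym (ℤ.+-assoc x _ _))

  sumℤ-map-applyUpTo : ∀ (F : ℕ → ℤ) (h : ℕ → ℕ) n → sumℤ (map F (applyUpTo h (suc n))) ≡ Y.sum≤ (F ∘ h) n
  sumℤ-map-applyUpTo F h zero    = ℤ.+-identityʳ _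
  sumℤ-map-applyUpTo F h (suc n) = ≡.cong (F (h 0) +ℤ_) (sumℤ-map-applyUpTo F (h ∘ suc) n)

  sumℤ-concatMap-applyUpTo : ∀ (G : ℕ → List ℤ) (h : ℕ → ℕ) n →
    sumℤ (concatMap G (applyUpTo h (suc n))) ≡ Y.sum≤ (λ i → sumℤ (G (h i))) n
  sumℤ-concatMap-applyUpTo G h zero    = ≡.trans (sumℤ-++ (G (h 0)) []) (ℤ.+-identityʳ _)
  sumℤ-concatMap-applyUpTo G h (suc n) =
    ≡.trans (sumℤ-++ (G (h 0)) _) (≡.cong (sumℤ (G (h 0)) +ℤ_) (sumℤ-concatMap-applyUpTo G (h ∘ suc) n))

  sum≤-pointwise : ∀ (F : ℕ → ℕ → ℤ) n b → XY.sum≤ F n b ≡ Y.sum≤ (λ i → F i b) n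
  sum≤-pointwise F zero    b = refl
  sum≤-pointwise F (suc n) b = ≡.cong (F 0 b +ℤ_) (sum≤-pointwise (F ∘ suc) n b)

  ⊗≈⋆ : ∀ f g → (f ⊗ g) XY.≋ (f XY.⋆ g)
  ⊗≈⋆ f g a b = begin
    (f ⊗ g) a b                               ≡⟨ sumℤ-concatMap-applyUpTo row id a ⟩
    Y.sum≤ (λ i → sumℤ (row i)) a             ≈⟨ Y.sum≤-cong (λ i → ≡⇒≈ (sumℤ-map-applyUpTo (term i) id b)) a ⟩
    Y.sum≤ (λ i → (f i Y.⋆ g (a ∸ i)) b) a   ≡⟨ sum≤-pointwise (λ i → f i Y.⋆ g (a ∸ i)) a b ⟨
    (f XY.⋆ g) a b                            ∎
    where
      open import Relation.Binary.Reasoning.Setoid (CommutativeRing.setoid ℤ/nℤ)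
      term : ℕ → ℕ → ℤ
      term i j = f i j ℤ.* g (a ∸ i) (b ∸ j)
      row : ℕ → List ℤ
      row i = map (term i) (upTo (suc b))

  -- Here _≈_ unfolds to divisibility, which does not determine its arguments, so implicit
  -- arguments are often given explicitly.
  one≈𝟙 : one XY.≋ XY.𝟙
  one≈𝟙 zero    zero    = ≡⇒≈ {1ℤ} refl
  one≈𝟙 zero    (suc b) = ≡⇒≈ {0ℤ} refl
  one≈𝟙 (suc a) b       = ≡⇒≈ {0ℤ} refl

  -- Poly, _≈[ p ]_, _⊕_, ⊖_, _⊗_ and one are literally the carrier and operations of this ring.
  𝔽ₚ⟦x,y⟧ : CommutativeRing _ _
  𝔽ₚ⟦x,y⟧ = WithMultiplication.commutativeRing XY.powerSeriesRing _⊗_ one ⊗≈⋆ one≈𝟙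

  open CommutativeRing 𝔽ₚ⟦x,y⟧ using (_≈_; setoid)
  open import Algebra.Properties.Semiring.Mult (CommutativeRing.semiring 𝔽ₚ⟦x,y⟧) using (_×_)

  p×≈0 : ∀ f → p × f ≈ (λ _ _ → 0ℤ)
  p×≈0 = XY.×ₛ-annihilates p (Y.×ₛ-annihilates p n×≈0)

  monomial₂ : ℕ → ℕ → Poly
  monomial₂ m n = XY.monomial m (Y.monomial n 1ℤ)

  mono≈monomial : ∀ m n → mono m n ≈ monomial₂ m n
  mono≈monomial m n a b with a ≟ m | b ≟ n
  ... | yes refl | yes refl = ≡⇒≈ (≡.sym (≡.trans (≡.cong (λ s → s b) (XY.monomial-diagonal a _))
                                                    (Y.monomial-diagonal b 1ℤ)))
  ... | yes refl | no b≢n   = ≡⇒≈ (≡.sym (≡.trans (≡.cong (λ s → s b) (XY.monomial-diagonal a _))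
                                                    (Y.monomial-off-diagonal 1ℤ b≢n)))
  ... | no a≢m   | _        = ≡⇒≈ (≡.sym (≡.cong (λ s → s b) (XY.monomial-off-diagonal _ a≢m)))

  mono-⊗ : ∀ a b c d → mono a b ⊗ mono c d ≈ mono (a ℕ.+ c) (b ℕ.+ d)
  mono-⊗ a b c d = begin
    mono a b ⊗ mono c d
      ≈⟨ ⊗≈⋆ (mono a b) (mono c d) ⟩
    mono a b XY.⋆ mono c d
      ≈⟨ XY.⋆-cong {mono a b} {monomial₂ a b} {mono c d} {monomial₂ c d} (mono≈monomial a b) (mono≈monomial c d) ⟩
    monomial₂ a b XY.⋆ monomial₂ c d
      ≈⟨ XY.monomial-⋆-monomial a c _ _ ⟩
    XY.monomial (a ℕ.+ c) (Y.monomial b 1ℤ Y.⋆ Y.monomial d 1ℤ)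
      ≈⟨ XY.monomial-cong (a ℕ.+ c) (Y.monomial-⋆-monomial b d 1ℤ 1ℤ) ⟩
    monomial₂ (a ℕ.+ c) (b ℕ.+ d)
      ≈⟨ mono≈monomial (a ℕ.+ c) (b ℕ.+ d) ⟨
    mono (a ℕ.+ c) (b ℕ.+ d)
      ∎
    where open import Relation.Binary.Reasoning.Setoid setoid

  mono-0-0 : mono 0 0 ≈ one
  mono-0-0 zero    zero    = ≡⇒≈ {1ℤ} refl
  mono-0-0 zero    (suc b) = ≡⇒≈ {0ℤ} refl
  mono-0-0 (suc a) b       = ≡⇒≈ {0ℤ} refl

  open import Algebra.Properties.CommutativeSemiring.Exp (CommutativeRing.commutativeSemiring 𝔽ₚ⟦x,y⟧) using (_^_)

  ^ᴾ≈^ : ∀ f n → f ^ᴾ n ≈ f ^ n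
  ^ᴾ≈^ f zero    = CommutativeRing.refl 𝔽ₚ⟦x,y⟧ {one}
  ^ᴾ≈^ f (suc n) = CommutativeRing.*-cong 𝔽ₚ⟦x,y⟧ {f} {f} {f ^ᴾ n} {f ^ n} (CommutativeRing.refl 𝔽ₚ⟦x,y⟧ {f}) (^ᴾ≈^ f n)

module PrimeBinomial where
  open import Data.Nat.Base
  open import Data.Nat.Properties
  open import Data.Nat.Divisibility
  open import Data.Nat.DivMod using (m/n*n≡m)
  open import Data.Nat.Primality
  open import Data.Nat.Combinatorics using (_C_; nCk≡n!/k![n-k]!; k![n∸k]!∣n!)
  open import Data.Sum.Base using (inj₁; inj₂)
  open import Relation.Nullary.Negation using (contradiction)
  open import Relation.Binary.PropositionalEquality

  prime∤! : ∀ {p} → Prime p → ∀ {n} → n < p → p ∤ n !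
  prime∤! p-prime {zero}  _   p∣1  = ¬prime[1] (subst Prime (∣1⇒≡1 p∣1) p-prime)
  prime∤! p-prime {suc n} n<p p∣n! with euclidsLemma (suc n) (n !) p-prime p∣n!
  ... | inj₁ p∣1+n = <⇒≱ n<p (∣⇒≤ p∣1+n)
  ... | inj₂ p∣n!  = prime∤! p-prime (<-trans (n<1+n n) n<p) p∣n!

  prime∣pCk : ∀ {p k} → Prime p → 0 < k → k < p → p ∣ p C k
  prime∣pCk {zero}      p-prime = contradiction p-prime ¬prime[0]
  prime∣pCk {p@(suc q)} {k} p-prime 0<k k<p
    with euclidsLemma (p C k) (k ! * (p ∸ k) !) p-prime p∣C*k!*[p-k]!
    where
      instance _ = k !* (p ∸ k) !≢0
      C*k!*[p-k]!≡p! : (p C k) * (k ! * (p ∸ k) !) ≡ p !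
      C*k!*[p-k]!≡p! = trans (cong (_* (k ! * (p ∸ k) !)) (nCk≡n!/k![n-k]! (<⇒≤ k<p)))
                             (m/n*n≡m (k![n∸k]!∣n! (<⇒≤ k<p)))
      p∣C*k!*[p-k]! : p ∣ (p C k) * (k ! * (p ∸ k) !)
      p∣C*k!*[p-k]! = subst (p ∣_) (sym C*k!*[p-k]!≡p!) (m∣m*n (q !))
  ... | inj₁ p∣C = p∣C
  ... | inj₂ p∣k!*[p-k]! with euclidsLemma (k !) ((p ∸ k) !) p-prime p∣k!*[p-k]!
  ...   | inj₁ p∣k!     = contradiction p∣k! (prime∤! p-prime k<p)
  ...   | inj₂ p∣[p-k]! = contradiction p∣[p-k]! (prime∤! p-prime (∸-monoʳ-< 0<k (<⇒≤ k<p)))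

module ThetaArithmetic where
  open import Data.Nat.Base
  open import Data.Nat.Properties using (m+n∸n≡m; +-comm; ^-distribˡ-+-*)
  open import Data.Nat.Tactic.RingSolver using (solve-∀)
  open import Relation.Binary.PropositionalEquality
  open ≡-Reasoning

  evenPowerSum : ℕ → ℕ → ℕ
  evenPowerSum p zero    = 1
  evenPowerSum p (suc m) = p * p * evenPowerSum p m + 1

  2*suc : ∀ m → 2 * suc m ≡ suc (suc (2 * m))
  2*suc = solve-∀

  module _ (q : ℕ) where
    private
      p : ℕ
      p = suc q
      G : ℕ → ℕ
      G = evenPowerSum p

    ^-[2m+2] : ∀ m → p ^ suc (suc (2 * m)) ≡ q * (q + 2) * G m + 1
    ^-[2m+2] zero    = p²≡ q
      where
        p²≡ : ∀ q → suc q * (suc q * 1) ≡ q * (q + 2) * 1 + 1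
        p²≡ = solve-∀
    ^-[2m+2] (suc m) = begin
      p * (p * p ^ (2 * suc m))             ≡⟨ cong (λ r → p * (p * p ^ r)) (2*suc m) ⟩
      p * (p * p ^ suc (suc (2 * m)))       ≡⟨ cong (λ x → p * (p * x)) (^-[2m+2] m) ⟩
      p * (p * (q * (q + 2) * G m + 1))     ≡⟨ step q (G m) ⟩
      q * (q + 2) * G (suc m) + 1           ∎
      where
        step : ∀ q g → suc q * (suc q * (q * (q + 2) * g + 1)) ≡ q * (q + 2) * (suc q * suc q * g + 1) + 1
        step = solve-∀

    θ-[2m+1] : ∀ m → θ (suc (2 * m)) p ≡ q * G m
    θ-[2m+2] : ∀ m → θ (suc (suc (2 * m))) p ≡ p * q * G m + 1

    θ-[2m+1] zero    = refl
    θ-[2m+1] (suc m) = begin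
      θ (suc (2 * suc m)) p                                 ≡⟨ cong (λ r → θ (suc r) p) (2*suc m) ⟩
      p * p ^ suc (suc (2 * m)) ∸ θ (suc (suc (2 * m))) p   ≡⟨ cong₂ (λ x t → p * x ∸ t) (^-[2m+2] m) (θ-[2m+2] m) ⟩
      p * (q * (q + 2) * G m + 1) ∸ (p * q * G m + 1)       ≡⟨ cong (_∸ (p * q * G m + 1)) (split q (G m)) ⟩
      q * G (suc m) + (p * q * G m + 1) ∸ (p * q * G m + 1) ≡⟨ m+n∸n≡m (q * G (suc m)) (p * q * G m + 1) ⟩
      q * G (suc m)                                         ∎
      where
        split : ∀ q g → suc q * (q * (q + 2) * g + 1) ≡ q * (suc q * suc q * g + 1) + (suc q * q * g + 1)
        split = solve-∀

    θ-[2m+2] m = begin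
      p ^ suc (suc (2 * m)) ∸ θ (suc (2 * m)) p             ≡⟨ cong₂ _∸_ (^-[2m+2] m) (θ-[2m+1] m) ⟩
      q * (q + 2) * G m + 1 ∸ q * G m                       ≡⟨ cong (_∸ q * G m) (split q (G m)) ⟩
      (p * q * G m + 1) + q * G m ∸ q * G m                 ≡⟨ m+n∸n≡m (p * q * G m + 1) (q * G m) ⟩
      p * q * G m + 1                                       ∎
      where
        split : ∀ q g → q * (q + 2) * g + 1 ≡ (suc q * q * g + 1) + q * g
        split = solve-∀

    θ-[2k-1] : ∀ m → θ (2 * suc m ∸ 1) p ≡ q * G m
    θ-[2k-1] m = trans (cong (λ r → θ (r ∸ 1) p) (2*suc m)) (θ-[2m+1] m)

    θ-[2k+1] : ∀ m → θ (2 * suc m + 1) p ≡ q * G (suc m)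
    θ-[2k+1] m = trans (cong (λ r → θ r p) (+-comm (2 * suc m) 1)) (θ-[2m+1] (suc m))

    ^-2k : ∀ m → p ^ (2 * suc m) ≡ q * (q + 2) * G m + 1
    ^-2k m = trans (cong (p ^_) (2*suc m)) (^-[2m+2] m)

    v-exponent : ∀ m → suc (p ^ 1) * θ (2 * suc m ∸ 1) p + 1 ≡ p ^ (2 * suc m)
    v-exponent m = begin
      suc (p ^ 1) * θ (2 * suc m ∸ 1) p + 1   ≡⟨ cong (λ t → suc (p ^ 1) * t + 1) (θ-[2k-1] m) ⟩
      suc (p ^ 1) * (q * G m) + 1             ≡⟨ identity q (G m) ⟩
      q * (q + 2) * G m + 1                   ≡⟨ ^-2k m ⟨
      p ^ (2 * suc m)                         ∎
      where
        -- p ^ 1 and p ^ 2 appear unfolded here and in u-exponent: the solver rejects them as written.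
        identity : ∀ q g → suc (suc q * 1) * (q * g) + 1 ≡ q * (q + 2) * g + 1
        identity = solve-∀

    u-exponent : ∀ m → suc (p ^ (2 * suc m)) + 2 * θ (2 * suc m + 1) p
                       ≡ p ^ 1 + p ^ (2 * suc m + 1) + suc (p ^ 2) * θ (2 * suc m ∸ 1) p
    u-exponent m = begin
      suc (p ^ (2 * suc m)) + 2 * θ (2 * suc m + 1) p
        ≡⟨ cong₂ (λ x t → suc x + 2 * t) (^-2k m) (θ-[2k+1] m) ⟩
      suc (q * (q + 2) * G m + 1) + 2 * (q * (p * p * G m + 1))
        ≡⟨ identity q (G m) ⟩
      p ^ 1 + (q * (q + 2) * G m + 1) * p ^ 1 + suc (p ^ 2) * (q * G m)
        ≡⟨ cong₂ (λ x t → p ^ 1 + x + suc (p ^ 2) * t)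
                 (trans (^-distribˡ-+-* p (2 * suc m) 1) (cong (_* p ^ 1) (^-2k m))) (θ-[2k-1] m) ⟨
      p ^ 1 + p ^ (2 * suc m + 1) + suc (p ^ 2) * θ (2 * suc m ∸ 1) p
        ∎
      where
        identity : ∀ q g → suc (q * (q + 2) * g + 1) + 2 * (q * (suc q * suc q * g + 1))
                           ≡ suc q * 1 + (q * (q + 2) * g + 1) * (suc q * 1) + suc (suc q * (suc q * 1)) * (q * g)
        identity = solve-∀

module MonomialNormalForm {c ℓ} (S : CommutativeSemiring c ℓ) (u v : CommutativeSemiring.Carrier S) where
  open CommutativeSemiring S
  open import Algebra.Properties.CommutativeSemiring.Exp S
  open import Algebra.Properties.CommutativeSemigroup *-commutativeSemigroup using (interchange)
  open import Relation.Binary.PropositionalEquality as ≡ using (_≡_)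
  open import Relation.Binary.Reasoning.Setoid setoid
  import Data.Nat.Properties as ℕ

  mon : ℕ → ℕ → Carrier
  mon a b = u ^ a * v ^ b

  mon-cong : ∀ {a a′ b b′} → a ≡ a′ → b ≡ b′ → mon a b ≈ mon a′ b′
  mon-cong a≡a′ b≡b′ = reflexive (≡.cong₂ mon a≡a′ b≡b′)

  mon-* : ∀ a b c d → mon a b * mon c d ≈ mon (a ℕ.+ c) (b ℕ.+ d)
  mon-* a b c d = trans (interchange _ _ _ _) (*-cong (sym (^-homo-* u a c)) (sym (^-homo-* v b d)))

  mon-^ : ∀ a b n → mon a b ^ n ≈ mon (a ℕ.* n) (b ℕ.* n)
  mon-^ a b n = trans (^-distrib-* (u ^ a) (v ^ b) n) (*-cong (^-assocʳ u a n) (^-assocʳ v b n))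

  u^≈mon : ∀ a → u ^ a ≈ mon a 0
  u^≈mon a = sym (*-identityʳ _)

  v^≈mon : ∀ b → v ^ b ≈ mon 0 b
  v^≈mon b = sym (*-identityˡ _)

  u≈mon : u ≈ mon 1 0
  u≈mon = trans (sym (*-identityʳ u)) (u^≈mon 1)

  v≈mon : v ≈ mon 0 1
  v≈mon = trans (sym (*-identityʳ v)) (v^≈mon 1)

  left-side-normal : ∀ a b n t →
    (v * v ^ a) ^ t * ((u * (v * u ^ b)) * u ^ n) ≈ mon (suc b ℕ.+ n) (suc a ℕ.* t ℕ.+ 1)
  left-side-normal a b n t = begin
    (v ^ suc a) ^ t * ((u * (v * u ^ b)) * u ^ n)
      ≈⟨ *-cong (^-congˡ t (v^≈mon (suc a))) (*-cong (*-cong u≈mon (*-cong v≈mon (u^≈mon b))) (u^≈mon n)) ⟩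
    mon 0 (suc a) ^ t * ((mon 1 0 * (mon 0 1 * mon b 0)) * mon n 0)
      ≈⟨ *-cong (mon-^ 0 (suc a) t) (*-congʳ (*-congˡ (mon-* 0 1 b 0))) ⟩
    mon 0 (suc a ℕ.* t) * ((mon 1 0 * mon b 1) * mon n 0)
      ≈⟨ *-congˡ (trans (*-congʳ (mon-* 1 0 b 1)) (mon-* (suc b) 1 n 0)) ⟩
    mon 0 (suc a ℕ.* t) * mon (suc b ℕ.+ n) 1
      ≈⟨ mon-* 0 (suc a ℕ.* t) (suc b ℕ.+ n) 1 ⟩
    mon (suc b ℕ.+ n) (suc a ℕ.* t ℕ.+ 1)
      ∎

  right-side-normal : ∀ a b c d t →
    ((u ^ a * (v ^ b * u ^ c)) * 1#) * (u * u ^ d) ^ t ≈ mon (a ℕ.+ c ℕ.+ suc d ℕ.* t) b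
  right-side-normal a b c d t = begin
    ((u ^ a * (v ^ b * u ^ c)) * 1#) * (u ^ suc d) ^ t
      ≈⟨ *-cong (trans (*-identityʳ _) (*-cong (u^≈mon a) (*-cong (v^≈mon b) (u^≈mon c)))) (^-congˡ t (u^≈mon (suc d))) ⟩
    (mon a 0 * (mon 0 b * mon c 0)) * mon (suc d) 0 ^ t
      ≈⟨ *-cong (trans (*-congˡ (mon-* 0 b c 0)) (mon-* a 0 c (b ℕ.+ 0))) (mon-^ (suc d) 0 t) ⟩
    mon (a ℕ.+ c) (b ℕ.+ 0) * mon (suc d ℕ.* t) 0
      ≈⟨ mon-* (a ℕ.+ c) (b ℕ.+ 0) (suc d ℕ.* t) 0 ⟩
    mon (a ℕ.+ c ℕ.+ suc d ℕ.* t) (b ℕ.+ 0 ℕ.+ 0)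
      ≈⟨ mon-cong {a ℕ.+ c ℕ.+ suc d ℕ.* t} ≡.refl (≡.trans (ℕ.+-identityʳ _) (ℕ.+-identityʳ b)) ⟩
    mon (a ℕ.+ c ℕ.+ suc d ℕ.* t) b
      ∎

module PrimeCharacteristic {c ℓ} (R : CommutativeRing c ℓ) where
  open CommutativeRing R hiding (zero)
  open import Algebra.Properties.Semiring.Mult semiring using (_×_; ×-assocˡ)
  open import Algebra.Properties.CommutativeSemiring.Exp commutativeSemiring

  module Frobenius {q : ℕ} (p-prime : Prime (suc q)) (p×≈0 : ∀ x → suc q × x ≈ 0#) where

    open import Algebra.Properties.Semiring.Sum semiring using (sum; sum-init-last; sum-cong-≋; sum-replicate-zero)
    import Algebra.Properties.CommutativeSemiring.Binomial commutativeSemiring as Binomial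
    open import Algebra.Properties.Ring ring using (-1*x≈-x)
    open import Algebra.Properties.Group +-group using (⁻¹-involutive; inverseʳ-unique)
    open import Data.Nat.Base using (z<s; s<s)
    import Data.Nat.Properties as ℕ
    open import Data.Nat.Divisibility using (divides)
    open import Data.Nat.Combinatorics using (_C_; nCn≡1)
    open import Data.Fin.Base using (Fin; zero; suc)
    open import Data.Fin.Properties using (toℕ-fromℕ; toℕ-inject₁; toℕ<n)
    open import Data.Vec.Functional using (init; last; replicate)
    import Relation.Binary.PropositionalEquality as ≡
    open import Relation.Binary.Reasoning.Setoid setoid
    open PrimeBinomial using (prime∣pCk)

    p : ℕ
    p = suc q

    pCk×≈0 : ∀ {k} → 0 < k → k < p → ∀ x → (p C k) × x ≈ 0#
    pCk×≈0 {k} 0<k k<p x with prime∣pCk p-prime 0<k k<p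
    ... | divides d pCk≡d*p = begin
      (p C k) × x       ≡⟨ ≡.cong (_× x) (≡.trans pCk≡d*p (ℕ.*-comm d p)) ⟩
      (p ℕ.* d) × x     ≈⟨ ×-assocˡ x p d ⟨
      p × (d × x)       ≈⟨ p×≈0 (d × x) ⟩
      0#                ∎

    frobenius-+ : ∀ x y → (x + y) ^ p ≈ x ^ p + y ^ p
    frobenius-+ x y = begin
      (x + y) ^ p                                          ≈⟨ Binomial.theorem p x y ⟩
      T zero + sum (T ∘ suc)                               ≈⟨ +-congˡ (sum-init-last (T ∘ suc)) ⟩
      T zero + (sum (init (T ∘ suc)) + last (T ∘ suc))     ≈⟨ +-cong first-term (+-cong middle-terms last-term) ⟩
      y ^ p + (0# + x ^ p)                                 ≈⟨ +-comm _ _ ⟩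
      (0# + x ^ p) + y ^ p                                 ≈⟨ +-congʳ (+-identityˡ _) ⟩
      x ^ p + y ^ p                                        ∎
      where
        T : Fin (suc p) → Carrier
        T = Binomial.binomialTerm x y p

        first-term : T zero ≈ y ^ p
        first-term = trans (+-identityʳ _) (*-identityˡ _)

        middle-term : ∀ (j : Fin q) → init (T ∘ suc) j ≈ replicate q 0# j
        middle-term j = pCk×≈0 z<s (s<s (≡.subst (_< q) (≡.sym (toℕ-inject₁ j)) (toℕ<n j))) _

        middle-terms : sum (init (T ∘ suc)) ≈ 0#
        middle-terms = trans (sum-cong-≋ middle-term) (sum-replicate-zero q)

        last-term : last (T ∘ suc) ≈ x ^ p
        last-term rewrite toℕ-fromℕ q | nCn≡1 p | ℕ.n∸n≡0 q = trans (+-identityʳ _) (*-identityʳ _)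

    1#^n≈1# : ∀ n → 1# ^ n ≈ 1#
    1#^n≈1# zero    = refl
    1#^n≈1# (suc n) = trans (*-identityˡ _) (1#^n≈1# n)

    [-1]^p≈-1 : (- 1#) ^ p ≈ - 1#
    [-1]^p≈-1 = inverseʳ-unique 1# _ (begin
      1# + (- 1#) ^ p        ≈⟨ +-congʳ (sym (1#^n≈1# p)) ⟩
      1# ^ p + (- 1#) ^ p    ≈⟨ frobenius-+ 1# (- 1#) ⟨
      (1# + - 1#) ^ p        ≈⟨ ^-congˡ p (-‿inverseʳ 1#) ⟩
      0# * 0# ^ q            ≈⟨ zeroˡ _ ⟩
      0#                     ∎)

    [-1]*[-1]≈1 : (- 1#) * (- 1#) ≈ 1#
    [-1]*[-1]≈1 = trans (-1*x≈-x (- 1#)) (⁻¹-involutive 1#)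

    [-1]^q≈1 : (- 1#) ^ q ≈ 1#
    [-1]^q≈1 = begin
      (- 1#) ^ q                          ≈⟨ *-identityˡ _ ⟨
      1# * (- 1#) ^ q                     ≈⟨ *-congʳ [-1]*[-1]≈1 ⟨
      ((- 1#) * (- 1#)) * (- 1#) ^ q      ≈⟨ *-assoc _ _ _ ⟩
      (- 1#) * (- 1#) ^ p                 ≈⟨ *-congˡ [-1]^p≈-1 ⟩
      (- 1#) * (- 1#)                     ≈⟨ [-1]*[-1]≈1 ⟩
      1#                                  ∎

    -x^[q*e]≈x^[q*e] : ∀ x e → (- x) ^ (q ℕ.* e) ≈ x ^ (q ℕ.* e)
    -x^[q*e]≈x^[q*e] x e = begin
      (- x) ^ (q ℕ.* e)                   ≈⟨ ^-congˡ (q ℕ.* e) (-1*x≈-x x) ⟨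
      ((- 1#) * x) ^ (q ℕ.* e)            ≈⟨ ^-distrib-* (- 1#) x (q ℕ.* e) ⟩
      (- 1#) ^ (q ℕ.* e) * x ^ (q ℕ.* e)  ≈⟨ *-congʳ (^-assocʳ (- 1#) q e) ⟨
      ((- 1#) ^ q) ^ e * x ^ (q ℕ.* e)    ≈⟨ *-congʳ (trans (^-congˡ e [-1]^q≈1) (1#^n≈1# e)) ⟩
      1# * x ^ (q ℕ.* e)                  ≈⟨ *-identityˡ _ ⟩
      x ^ (q ℕ.* e)                       ∎

    frobenius-neg : ∀ x → (- x) ^ p ≈ - x ^ p
    frobenius-neg x = begin
      (- x) ^ p               ≈⟨ ^-congˡ p (-1*x≈-x x) ⟨
      ((- 1#) * x) ^ p        ≈⟨ ^-distrib-* (- 1#) x p ⟩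
      (- 1#) ^ p * x ^ p      ≈⟨ *-congʳ [-1]^p≈-1 ⟩
      (- 1#) * x ^ p          ≈⟨ -1*x≈-x _ ⟩
      - x ^ p                 ∎

    frobenius-minus : ∀ x y → (x - y) ^ p ≈ x ^ p - y ^ p
    frobenius-minus x y = trans (frobenius-+ x (- y)) (+-congˡ (frobenius-neg y))

    frobenius-iterate-minus : ∀ n x y → (x - y) ^ (p ℕ.^ n) ≈ x ^ (p ℕ.^ n) - y ^ (p ℕ.^ n)
    frobenius-iterate-minus zero    x y = trans (*-identityʳ _) (sym (+-cong (*-identityʳ x) (-‿cong (*-identityʳ y))))
    frobenius-iterate-minus (suc n) x y = begin
      (x - y) ^ (p ℕ.* p ℕ.^ n)                   ≈⟨ ^-assocʳ (x - y) p (p ℕ.^ n) ⟨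
      ((x - y) ^ p) ^ (p ℕ.^ n)                   ≈⟨ ^-congˡ (p ℕ.^ n) (frobenius-minus x y) ⟩
      (x ^ p - y ^ p) ^ (p ℕ.^ n)                 ≈⟨ frobenius-iterate-minus n (x ^ p) (y ^ p) ⟩
      (x ^ p) ^ (p ℕ.^ n) - (y ^ p) ^ (p ℕ.^ n)   ≈⟨ +-cong (^-assocʳ x p (p ℕ.^ n)) (-‿cong (^-assocʳ y p (p ℕ.^ n))) ⟩
      x ^ (p ℕ.* p ℕ.^ n) - y ^ (p ℕ.* p ℕ.^ n)   ∎

  module Brackets {q : ℕ} (p-prime : Prime (suc q)) (p×≈0 : ∀ x → suc q × x ≈ 0#)
    (M : ℕ → ℕ → Carrier) (M-* : ∀ a b c d → M a b * M c d ≈ M (a ℕ.+ c) (b ℕ.+ d)) (M-0-0 : M 0 0 ≈ 1#)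
    where

    open import Data.Nat.Base using (_≤_; s≤s)
    import Data.Nat.Properties as ℕ
    open import Relation.Binary.PropositionalEquality as ≡ using (_≡_)
    open import Relation.Binary.Reasoning.Setoid setoid
    open Frobenius p-prime p×≈0 using (p; frobenius-iterate-minus; -x^[q*e]≈x^[q*e]; 1#^n≈1#)
    open ThetaArithmetic

    [_,_] : ℕ → ℕ → Carrier
    [ i , j ] = M (p ℕ.^ i) (p ℕ.^ j) - M (p ℕ.^ j) (p ℕ.^ i)

    M-cong : ∀ {a a′ b b′} → a ≡ a′ → b ≡ b′ → M a b ≈ M a′ b′
    M-cong a≡a′ b≡b′ = reflexive (≡.cong₂ M a≡a′ b≡b′)

    M-^ : ∀ a b n → M a b ^ n ≈ M (n ℕ.* a) (n ℕ.* b)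
    M-^ a b zero    = sym M-0-0
    M-^ a b (suc n) = trans (*-congˡ (M-^ a b n)) (M-* a b (n ℕ.* a) (n ℕ.* b))

    bracket-shift : ∀ n j → [ n , n ℕ.+ j ] ≈ [ 0 , j ] ^ (p ℕ.^ n)
    bracket-shift n j = sym (begin
      [ 0 , j ] ^ (p ℕ.^ n)
        ≈⟨ frobenius-iterate-minus n (M 1 (p ℕ.^ j)) (M (p ℕ.^ j) 1) ⟩
      M 1 (p ℕ.^ j) ^ (p ℕ.^ n) - M (p ℕ.^ j) 1 ^ (p ℕ.^ n)
        ≈⟨ +-cong (M-^ 1 (p ℕ.^ j) (p ℕ.^ n)) (-‿cong (M-^ (p ℕ.^ j) 1 (p ℕ.^ n))) ⟩
      M (p ℕ.^ n ℕ.* 1) (p ℕ.^ n ℕ.* p ℕ.^ j) - M (p ℕ.^ n ℕ.* p ℕ.^ j) (p ℕ.^ n ℕ.* 1)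
        ≈⟨ +-cong (M-cong p^n*1 p^n*p^j) (-‿cong (M-cong p^n*p^j p^n*1)) ⟩
      [ n , n ℕ.+ j ]
        ∎)
      where
        p^n*1 : p ℕ.^ n ℕ.* 1 ≡ p ℕ.^ n
        p^n*1 = ℕ.*-identityʳ (p ℕ.^ n)
        p^n*p^j : p ℕ.^ n ℕ.* p ℕ.^ j ≡ p ℕ.^ (n ℕ.+ j)
        p^n*p^j = ≡.sym (ℕ.^-distribˡ-+-* p n j)

    open MonomialNormalForm commutativeSemiring [ 0 , 1 ] [ 0 , 2 ] using (mon; mon-cong; left-side-normal; right-side-normal)

    bracket-identity : ∀ k → 1 ≤ k →
      (- ([ 0 , 2 ] * [ 1 , 3 ])) ^ θ (2 ℕ.* k ∸ 1) p
        * (([ 0 , 1 ] * ([ 0 , 2 ] * [ 2 ℕ.* k , 2 ℕ.* k ℕ.+ 1 ])) * [ 0 , 1 ] ^ (2 ℕ.* θ (2 ℕ.* k ℕ.+ 1) p))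
      ≈ (([ 1 , 2 ] * ([ 2 ℕ.* k , 2 ℕ.* k ℕ.+ 2 ] * [ 2 ℕ.* k ℕ.+ 1 , 2 ℕ.* k ℕ.+ 2 ])) * 1# ^ (2 ℕ.* θ (2 ℕ.* k ℕ.+ 1) p))
        * ([ 0 , 1 ] * [ 2 , 3 ]) ^ θ (2 ℕ.* k ∸ 1) p
    bracket-identity (suc m) (s≤s _) = begin
      (- (v * [ 1 , 3 ])) ^ θ₁ * ((u * (v * [ K , K ℕ.+ 1 ])) * u ^ n₂)
        ≈⟨ *-cong (trans sign-vanishes (^-congˡ θ₁ (*-congˡ (bracket-shift 1 2))))
                  (*-congʳ (*-congˡ (*-congˡ (bracket-shift K 1)))) ⟩
      (v * v ^ (p ℕ.^ 1)) ^ θ₁ * ((u * (v * u ^ P)) * u ^ n₂)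
        ≈⟨ left-side-normal (p ℕ.^ 1) P n₂ θ₁ ⟩
      mon (suc P ℕ.+ n₂) (suc (p ℕ.^ 1) ℕ.* θ₁ ℕ.+ 1)
        ≈⟨ mon-cong (u-exponent q m) (v-exponent q m) ⟩
      mon (p ℕ.^ 1 ℕ.+ p ℕ.^ (K ℕ.+ 1) ℕ.+ suc (p ℕ.^ 2) ℕ.* θ₁) P
        ≈⟨ right-side-normal (p ℕ.^ 1) P (p ℕ.^ (K ℕ.+ 1)) (p ℕ.^ 2) θ₁ ⟨
      ((u ^ (p ℕ.^ 1) * (v ^ P * u ^ (p ℕ.^ (K ℕ.+ 1)))) * 1#) * (u * u ^ (p ℕ.^ 2)) ^ θ₁
        ≈⟨ *-cong (*-cong (*-cong (bracket-shift 1 1) (*-cong (bracket-shift K 2) [K+1,K+2]≈)) (1#^n≈1# n₂))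
                  (^-congˡ θ₁ (*-congˡ (bracket-shift 2 1))) ⟨
      (([ 1 , 2 ] * ([ K , K ℕ.+ 2 ] * [ K ℕ.+ 1 , K ℕ.+ 2 ])) * 1# ^ n₂) * (u * [ 2 , 3 ]) ^ θ₁
        ∎
      where
        u v : Carrier
        u = [ 0 , 1 ]
        v = [ 0 , 2 ]
        K θ₁ n₂ P : ℕ
        K  = 2 ℕ.* suc m
        θ₁ = θ (K ∸ 1) p
        n₂ = 2 ℕ.* θ (K ℕ.+ 1) p
        P  = p ℕ.^ K

        sign-vanishes : (- (v * [ 1 , 3 ])) ^ θ₁ ≈ (v * [ 1 , 3 ]) ^ θ₁
        sign-vanishes = begin
          (- (v * [ 1 , 3 ])) ^ θ₁                         ≈⟨ ^-congʳ _ (θ-[2k-1] q m) ⟩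
          (- (v * [ 1 , 3 ])) ^ (q ℕ.* evenPowerSum p m)   ≈⟨ -x^[q*e]≈x^[q*e] _ _ ⟩
          (v * [ 1 , 3 ]) ^ (q ℕ.* evenPowerSum p m)       ≈⟨ ^-congʳ _ (θ-[2k-1] q m) ⟨
          (v * [ 1 , 3 ]) ^ θ₁                             ∎

        [K+1,K+2]≈ : [ K ℕ.+ 1 , K ℕ.+ 2 ] ≈ u ^ (p ℕ.^ (K ℕ.+ 1))
        [K+1,K+2]≈ = trans (reflexive (≡.cong (λ j → [ K ℕ.+ 1 , j ]) (≡.sym (ℕ.+-assoc K 1 1))))
                           (bracket-shift (K ℕ.+ 1) 1)

    -- Stated for any power operation agreeing with _^_, so that it applies verbatim to _^ᴾ_.
    bracket-identity-with : (_^′_ : Carrier → ℕ → Carrier) → (∀ x n → x ^′ n ≈ x ^ n) → ∀ k → 1 ≤ k →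
      (- ([ 0 , 2 ] * [ 1 , 3 ])) ^′ θ (2 ℕ.* k ∸ 1) p
        * (([ 0 , 1 ] * ([ 0 , 2 ] * [ 2 ℕ.* k , 2 ℕ.* k ℕ.+ 1 ])) * [ 0 , 1 ] ^′ (2 ℕ.* θ (2 ℕ.* k ℕ.+ 1) p))
      ≈ (([ 1 , 2 ] * ([ 2 ℕ.* k , 2 ℕ.* k ℕ.+ 2 ] * [ 2 ℕ.* k ℕ.+ 1 , 2 ℕ.* k ℕ.+ 2 ])) * 1# ^′ (2 ℕ.* θ (2 ℕ.* k ℕ.+ 1) p))
        * ([ 0 , 1 ] * [ 2 , 3 ]) ^′ θ (2 ℕ.* k ∸ 1) p
    bracket-identity-with _^′_ ^′≈^ k 1≤k =
      trans (*-cong (^′≈^ _ _) (*-congˡ (^′≈^ _ _)))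
        (trans (bracket-identity k 1≤k) (sym (*-cong (*-congˡ (^′≈^ _ _)) (^′≈^ _ _))))

open import Data.Nat using (ℕ; _≤_; _*_; _+_; _∸_)
open import Data.Nat.Primality using (¬prime[0])
open import Relation.Nullary.Negation using (contradiction)

lemmaA1 : (p : ℕ) → Prime p → (k : ℕ) → 1 ≤ k →
    (ν p ^F θ (2 * k ∸ 1) p)
      ≈F[ p ]
    (((br p 1 2 ⊗ (br p (2 * k) (2 * k + 2) ⊗ br p (2 * k + 1) (2 * k + 2)))
        // (br p 0 1 ⊗ (br p 0 2 ⊗ br p (2 * k) (2 * k + 1))))
      *F (poly (br p 0 1) ^F- (2 * θ (2 * k + 1) p)))
lemmaA1 zero    p-prime = contradiction p-prime ¬prime[0]
lemmaA1 (suc q) p-prime = bracket-identity-with _^ᴾ_ ^ᴾ≈^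
  where
    open BivariatePowerSeries (suc q)
    open PrimeCharacteristic 𝔽ₚ⟦x,y⟧
    open Brackets p-prime p×≈0 mono mono-⊗ mono-0-0
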